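{- Let $M$ be a finite $R$-module and $N$ a finite $R'$-module, and let $A\subseteq R$, $B\subseteq R'$. Regarding $M\times N$ as a module over $R\times R'$, we have $D_{A\times B}(M\times N)\ge D_A(M)+D_B(N)-1$.
   Context: $R,R'$ are rings with unity. For a finite $R$-module $M$, $A\subseteq R$ and a sequence $(x_1,\ldots,x_k)$ in $M$, an $A$-weighted zero-sum subsequence is given by a non-empty set $I\subseteq[1,k]$ and $a_i\in A$ ($i\in I$) with $\sum_{i\in I}a_ix_i=0$. $D_A(M)$ is the least positive integer $k$ such that every sequence in $M$ of length $k$ has an $A$-weighted zero-sum subsequence. -}

module Defs where

open import Level using (Level; _⊔_)
open import Data.Nat using (ℕ; zero; suc; _<_; _≤_)
open import Data.Fin using (Fin)
import Data.Fin as Fin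
open import Relation.Binary.PropositionalEquality using (_≡_)
open import Data.Bool using (Bool; true; false)
open import Data.Product using (Σ; ∃; _×_; _,_; proj₁; proj₂; map; zip)
open import Relation.Unary using (Pred)
open import Relation.Nullary using (¬_)
open import Algebra.Bundles using (Ring)
open import Algebra.Module.Bundles using (LeftModule)
import Algebra.Construct.DirectProduct as DP

private
  variable
    r ℓr r′ ℓr′ m ℓm m′ ℓm′ : Level

_×ᴿ_ : Ring r ℓr → Ring r′ ℓr′ → Ring (r ⊔ r′) (ℓr ⊔ ℓr′)
R ×ᴿ R′ = DP.ring R R′

_⊠_ : {R : Ring r ℓr} {R′ : Ring r′ ℓr′} →
      LeftModule R m ℓm → LeftModule R′ m′ ℓm′ →
      LeftModule (R ×ᴿ R′) (m ⊔ m′) (ℓm ⊔ ℓm′)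
_⊠_ {R = R} {R′ = R′} M N = record
  { Carrierᴹ = M.Carrierᴹ × N.Carrierᴹ
  ; _≈ᴹ_ = λ u v → (proj₁ u M.≈ᴹ proj₁ v) × (proj₂ u N.≈ᴹ proj₂ v)
  ; _+ᴹ_ = zip M._+ᴹ_ N._+ᴹ_
  ; _*ₗ_ = λ a u → (proj₁ a M.*ₗ proj₁ u) , (proj₂ a N.*ₗ proj₂ u)
  ; 0ᴹ = M.0ᴹ , N.0ᴹ
  ; -ᴹ_ = map M.-ᴹ_ N.-ᴹ_
  ; isLeftModule = record
    { isLeftSemimodule = record
      { +ᴹ-isCommutativeMonoid = record
        { isMonoid = record
          { isSemigroup = record
            { isMagma = record
              { isEquivalence = record
                { refl = M.≈ᴹ-refl , N.≈ᴹ-refl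
                ; sym = λ (p , q) → M.≈ᴹ-sym p , N.≈ᴹ-sym q
                ; trans = λ (p , q) (p′ , q′) → M.≈ᴹ-trans p p′ , N.≈ᴹ-trans q q′
                }
              ; ∙-cong = λ (p , q) (p′ , q′) → M.+ᴹ-cong p p′ , N.+ᴹ-cong q q′
              }
            ; assoc = λ x y z → M.+ᴹ-assoc (proj₁ x) (proj₁ y) (proj₁ z)
                              , N.+ᴹ-assoc (proj₂ x) (proj₂ y) (proj₂ z)
            }
          ; identity = (λ x → M.+ᴹ-identityˡ (proj₁ x) , N.+ᴹ-identityˡ (proj₂ x))
                     , (λ x → M.+ᴹ-identityʳ (proj₁ x) , N.+ᴹ-identityʳ (proj₂ x))
          }
        ; comm = λ x y → M.+ᴹ-comm (proj₁ x) (proj₁ y) , N.+ᴹ-comm (proj₂ x) (proj₂ y)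
        }
      ; isPreleftSemimodule = record
        { *ₗ-cong = λ (p , q) (p′ , q′) → M.*ₗ-cong p p′ , N.*ₗ-cong q q′
        ; *ₗ-zeroˡ = λ x → M.*ₗ-zeroˡ (proj₁ x) , N.*ₗ-zeroˡ (proj₂ x)
        ; *ₗ-distribʳ = λ x a b → M.*ₗ-distribʳ (proj₁ x) (proj₁ a) (proj₁ b)
                                , N.*ₗ-distribʳ (proj₂ x) (proj₂ a) (proj₂ b)
        ; *ₗ-identityˡ = λ x → M.*ₗ-identityˡ (proj₁ x) , N.*ₗ-identityˡ (proj₂ x)
        ; *ₗ-assoc = λ a b x → M.*ₗ-assoc (proj₁ a) (proj₁ b) (proj₁ x)
                             , N.*ₗ-assoc (proj₂ a) (proj₂ b) (proj₂ x)
        ; *ₗ-zeroʳ = λ a → M.*ₗ-zeroʳ (proj₁ a) , N.*ₗ-zeroʳ (proj₂ a)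
        ; *ₗ-distribˡ = λ a x y → M.*ₗ-distribˡ (proj₁ a) (proj₁ x) (proj₁ y)
                                , N.*ₗ-distribˡ (proj₂ a) (proj₂ x) (proj₂ y)
        }
      }
    ; -ᴹ‿cong = λ (p , q) → M.-ᴹ‿cong p , N.-ᴹ‿cong q
    ; -ᴹ‿inverse = (λ x → M.-ᴹ‿inverseˡ (proj₁ x) , N.-ᴹ‿inverseˡ (proj₂ x))
                 , (λ x → M.-ᴹ‿inverseʳ (proj₁ x) , N.-ᴹ‿inverseʳ (proj₂ x))
    }
  }
  where
  module M = LeftModule M
  module N = LeftModule N

_×ˢ_ : {R : Set r} {R′ : Set r′} {a b : Level} →
       Pred R a → Pred R′ b → Pred (R × R′) (a ⊔ b)
(A ×ˢ B) (x , y) = A x × B y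

module _ {R : Ring r ℓr} (M : LeftModule R m ℓm) where
  open Ring R using (Carrier)
  open LeftModule M

  IsFinite : Set (m ⊔ ℓm)
  IsFinite = Σ ℕ λ n → Σ (Fin n → Carrierᴹ) λ enum → ∀ x → ∃ λ i → enum i ≈ᴹ x

  sumᴹ : ∀ k → (Fin k → Carrierᴹ) → Carrierᴹ
  sumᴹ zero    f = 0ᴹ
  sumᴹ (suc k) f = f Fin.zero +ᴹ sumᴹ k (λ i → f (Fin.suc i))

  -- An A-weighted zero-sum subsequence of x : Fin k → M is given by a
  -- non-empty index set I ⊆ [1,k] (as a characteristic function) and
  -- weights aᵢ ∈ A (i ∈ I) with Σ_{i∈I} aᵢ xᵢ = 0.
  HasWeightedZeroSumSubseq : ∀ {a} → Pred Carrier a → ∀ k → (Fin k → Carrierᴹ) → Set (r ⊔ a ⊔ ℓm)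
  HasWeightedZeroSumSubseq A k x =
    Σ (Fin k → Bool) λ I →
    Σ (Fin k → Carrier) λ w →
      (∃ λ i → I i ≡ true)
    × (∀ i → I i ≡ true → A (w i))
    × (sumᴹ k (λ i → term (I i) (w i) (x i)) ≈ᴹ 0ᴹ)
    where
    term : Bool → Carrier → Carrierᴹ → Carrierᴹ
    term true  c y = c *ₗ y
    term false c y = 0ᴹ

  AllHaveWZS : ∀ {a} → Pred Carrier a → ℕ → Set (r ⊔ m ⊔ a ⊔ ℓm)
  AllHaveWZS A k = (x : Fin k → Carrierᴹ) → HasWeightedZeroSumSubseq A k x

  IsDavenport : ∀ {a} → Pred Carrier a → ℕ → Set (r ⊔ m ⊔ a ⊔ ℓm)
  IsDavenport A d = (1 ≤ d) × AllHaveWZS A d × (∀ k → 1 ≤ k → k < d → ¬ AllHaveWZS A k)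

{-# OPTIONS --safe #-}
module Submission where

open import Defs
open import Level using (Level)
open import Data.Nat using (ℕ; zero; suc; _+_; _∸_; _≤_; _≤′_; ≤′-refl; ≤′-step; s≤s; z≤n)
open import Relation.Unary using (Pred)
open import Algebra.Bundles using (Ring)
open import Algebra.Module.Bundles using (LeftModule)

open import Data.Nat.Properties using (≤⇒≤′; ≰⇒>; +-suc; n<1+n)
open import Data.Fin using (Fin; zero; suc; _↑ˡ_; _↑ʳ_; splitAt)
open import Data.Fin.Properties using (splitAt⁻¹-↑ˡ; splitAt⁻¹-↑ʳ)
open import Data.Vec.Functional using (_∷_; _++_; tail; replicate; zipWith)
open import Data.Vec.Functional.Properties using (lookup-++ˡ; lookup-++ʳ)
open import Data.Bool using (Bool; true; false; if_then_else_)
open import Data.Bool.Properties using (if-float)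
open import Data.Product using (Σ; ∃; _×_; _,_; proj₁; proj₂)
open import Data.Sum using (_⊎_; inj₁; inj₂; [_,_]′; swap)
import Data.Sum as Sum
open import Function using (_∘_; id; const; _⇔_; mk⇔; Equivalence)
open import Relation.Nullary using (¬_)
open import Relation.Binary.Bundles using (Setoid)
open import Relation.Binary.PropositionalEquality using (_≡_; refl; sym; cong₂; subst)

-- If x ∈ M^(d-1) and y ∈ N^(e-1) have no weighted zero-sum subsequence, neither has the
-- concatenation of the (xᵢ , 0) and the (0 , yⱼ) over A × B: the M-component of a zero-sum
-- is one for x on the indices in the first block, the N-component one for y on the second
-- block, and one of the two blocks meets the index set. Constructively we argue the other way
-- round: if every sequence of length d + e - 2 in M × N has a zero-sum, then for all x and y
-- either x or y has one, and finiteness of M and N lets us conclude that every x or every y has.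

module _ {p t : Level} {P : Set p} where

  ⊎-∀-Fin : ∀ {n} {T : Fin n → Set t} → (∀ j → P ⊎ T j) → P ⊎ (∀ j → T j)
  ⊎-∀-Fin {zero}  h = inj₂ λ ()
  ⊎-∀-Fin {suc n} h with h zero | ⊎-∀-Fin (h ∘ suc)
  ... | inj₁ p  | _       = inj₁ p
  ... | inj₂ _  | inj₁ p  = inj₁ p
  ... | inj₂ t₀ | inj₂ ts = inj₂ λ { zero → t₀ ; (suc j) → ts j }

module _ {c ℓ} (X : Setoid c ℓ) {n} (enum : Fin n → Setoid.Carrier X)
         (enum-surjective : ∀ x → ∃ λ j → Setoid._≈_ X (enum j) x) where
  open Setoid X using (Carrier; _≈_) renaming (refl to ≈-refl)

  ⊎-∀-sequences : ∀ {p s} {P : Set p} k {S : (Fin k → Carrier) → Set s} →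
    (∀ {y y′} → (∀ i → y i ≈ y′ i) → S y → S y′) →
    (∀ y → P ⊎ S y) → P ⊎ (∀ y → S y)
  ⊎-∀-sequences zero    resp h = Sum.map₂ (λ S[] y → resp (λ ()) S[]) (h λ ())
  ⊎-∀-sequences (suc k) {S} resp h =
    Sum.map₂ fromHeads (⊎-∀-Fin λ j → ⊎-∀-sequences k (resp ∘ ∷-cong) (h ∘ (enum j ∷_)))
    where
    ∷-cong : ∀ {a y y′} → (∀ i → y i ≈ y′ i) → ∀ i → (a ∷ y) i ≈ (a ∷ y′) i
    ∷-cong y≈y′ zero    = ≈-refl
    ∷-cong y≈y′ (suc i) = y≈y′ i
    fromHeads : (∀ j y′ → S (enum j ∷ y′)) → ∀ y → S y
    fromHeads S∷ y with enum-surjective (y zero)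
    ... | j , enum[j]≈y₀ = resp (λ { zero → enum[j]≈y₀ ; (suc i) → ≈-refl }) (S∷ j (tail y))

∃-↑ˡ⊎↑ʳ : ∀ m {n ℓ} {P : Pred (Fin (m + n)) ℓ} → ∃ P → ∃ (P ∘ (_↑ˡ n)) ⊎ ∃ (P ∘ (m ↑ʳ_))
∃-↑ˡ⊎↑ʳ m {P = P} (i , Pi) with splitAt m i in eq
... | inj₁ j = inj₁ (j , subst P (sym (splitAt⁻¹-↑ˡ eq)) Pi)
... | inj₂ j = inj₂ (j , subst P (sym (splitAt⁻¹-↑ʳ eq)) Pi)

summand-by-cases : ∀ {a b k} {W : Set a} {B : Set b} (τ : (Fin k → Bool) → (Fin k → W) → Fin k → B) →
  (∀ I w i → τ I w i ≡ τ (const (I i)) (const (w i)) i) →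
  ∀ I w i → τ I w i ≡ (if I i then τ (const true) (const (w i)) i else τ (const false) (const (w i)) i)
summand-by-cases τ local I w i with I i | local I w i
... | true  | τIwi≡ = τIwi≡
... | false | τIwi≡ = τIwi≡

module WeightedSums {r ℓr m ℓm} {R : Ring r ℓr} (M : LeftModule R m ℓm) where
  open Ring R using (Carrier; 0#)
  open LeftModule M

  sumᴹ-cong : ∀ {k} {f g : Fin k → Carrierᴹ} → (∀ i → f i ≈ᴹ g i) → sumᴹ M k f ≈ᴹ sumᴹ M k g
  sumᴹ-cong {zero}  f≈g = ≈ᴹ-refl
  sumᴹ-cong {suc k} f≈g = +ᴹ-cong (f≈g zero) (sumᴹ-cong (f≈g ∘ suc))

  sumᴹ-zero : ∀ {k} {f : Fin k → Carrierᴹ} → (∀ i → f i ≈ᴹ 0ᴹ) → sumᴹ M k f ≈ᴹ 0ᴹ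
  sumᴹ-zero {zero}  f≈0 = ≈ᴹ-refl
  sumᴹ-zero {suc k} f≈0 = ≈ᴹ-trans (+ᴹ-cong (f≈0 zero) (sumᴹ-zero (f≈0 ∘ suc))) (+ᴹ-identityˡ 0ᴹ)

  sumᴹ-++ : ∀ p {q} (f : Fin (p + q) → Carrierᴹ) →
    sumᴹ M (p + q) f ≈ᴹ sumᴹ M p (f ∘ (_↑ˡ q)) +ᴹ sumᴹ M q (f ∘ (p ↑ʳ_))
  sumᴹ-++ zero    f = ≈ᴹ-sym (+ᴹ-identityˡ _)
  sumᴹ-++ (suc p) f = ≈ᴹ-trans (+ᴹ-cong ≈ᴹ-refl (sumᴹ-++ p (f ∘ suc))) (≈ᴹ-sym (+ᴹ-assoc _ _ _))

  Summand : ℕ → Set (r Level.⊔ m)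
  Summand k = (Fin k → Bool) → (Fin k → Carrier) → Fin k → Carrierᴹ

  ZeroSumOf : ∀ {a} {k} → Summand k → Pred Carrier a → Set (r Level.⊔ a Level.⊔ ℓm)
  ZeroSumOf {k = k} τ A =
    Σ (Fin k → Bool) λ I →
    Σ (Fin k → Carrier) λ w →
      (∃ λ i → I i ≡ true)
    × (∀ i → I i ≡ true → A (w i))
    × (sumᴹ M k (τ I w) ≈ᴹ 0ᴹ)

  ZeroSumOf-cong : ∀ {a} {A : Pred Carrier a} {k} {τ τ′ : Summand k} →
    (∀ I w i → τ I w i ≈ᴹ τ′ I w i) → ZeroSumOf τ A → ZeroSumOf τ′ A
  ZeroSumOf-cong τ≈τ′ (I , w , I≢∅ , A[w] , Σ≈0) =
    I , w , I≢∅ , A[w] , ≈ᴹ-trans (sumᴹ-cong λ i → ≈ᴹ-sym (τ≈τ′ I w i)) Σ≈0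

  ZeroSumOf-by-cases : ∀ {a} {A : Pred Carrier a} {k} (τ : Summand k) →
    (∀ I w i → τ I w i ≡ τ (const (I i)) (const (w i)) i) →
    ZeroSumOf τ A ⇔ ZeroSumOf (λ I w i → if I i then τ (const true) (const (w i)) i
                                                 else τ (const false) (const (w i)) i) A
  ZeroSumOf-by-cases {A = A} τ local =
    mk⇔ (ZeroSumOf-cong {A = A} τ≈cases) (ZeroSumOf-cong {A = A} (λ I w i → ≈ᴹ-sym (τ≈cases I w i)))
    where
    τ≈cases : ∀ I w i → τ I w i ≈ᴹ (if I i then τ (const true) (const (w i)) i
                                       else τ (const false) (const (w i)) i)
    τ≈cases I w i = ≈ᴹ-reflexive (summand-by-cases τ local I w i)

  weighted : ∀ {k} → (Fin k → Carrierᴹ) → Summand k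
  weighted x I w i = if I i then w i *ₗ x i else 0ᴹ

  WeightedZeroSum : ∀ {a} → Pred Carrier a → ∀ k → (Fin k → Carrierᴹ) → Set (r Level.⊔ a Level.⊔ ℓm)
  WeightedZeroSum A k x = ZeroSumOf (weighted x) A

  -- The summand of `HasWeightedZeroSumSubseq` is local to its definition; it is recovered
  -- as the τ of `ZeroSumOf-by-cases` by unification, and its two cases are those of `weighted x`.
  module _ {a} {A : Pred Carrier a} {k} {x : Fin k → Carrierᴹ} where

    HasWeightedZeroSumSubseq⇒WeightedZeroSum : HasWeightedZeroSumSubseq M A k x → WeightedZeroSum A k x
    HasWeightedZeroSumSubseq⇒WeightedZeroSum = Equivalence.to (ZeroSumOf-by-cases {A = A} _ (λ _ _ _ → refl))

    WeightedZeroSum⇒HasWeightedZeroSumSubseq : WeightedZeroSum A k x → HasWeightedZeroSumSubseq M A k x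
    WeightedZeroSum⇒HasWeightedZeroSumSubseq = Equivalence.from (ZeroSumOf-by-cases {A = A} _ (λ _ _ _ → refl))

  weighted-cong : ∀ {k} {x x′ : Fin k → Carrierᴹ} → (∀ i → x i ≈ᴹ x′ i) →
    ∀ I w i → weighted x I w i ≈ᴹ weighted x′ I w i
  weighted-cong x≈x′ I w i with I i
  ... | true  = *ₗ-cong (Ring.refl R) (x≈x′ i)
  ... | false = ≈ᴹ-refl

  weighted-zeros : ∀ {k} I w i → weighted (replicate k 0ᴹ) I w i ≈ᴹ 0ᴹ
  weighted-zeros I w i with I i
  ... | true  = *ₗ-zeroʳ (w i)
  ... | false = ≈ᴹ-refl

  sumᴹ-weighted-++ : ∀ p {q} (x : Fin p → Carrierᴹ) (y : Fin q → Carrierᴹ) I w →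
    sumᴹ M (p + q) (weighted (x ++ y) I w)
      ≈ᴹ sumᴹ M p (weighted x (I ∘ (_↑ˡ q)) (w ∘ (_↑ˡ q)))
      +ᴹ sumᴹ M q (weighted y (I ∘ (p ↑ʳ_)) (w ∘ (p ↑ʳ_)))
  sumᴹ-weighted-++ p x y I w = ≈ᴹ-trans (sumᴹ-++ p _)
    (+ᴹ-cong (sumᴹ-cong (weighted-cong (≈ᴹ-reflexive ∘ lookup-++ˡ x y) _ _))
             (sumᴹ-cong (weighted-cong (≈ᴹ-reflexive ∘ lookup-++ʳ x y) _ _)))

  sumᴹ-weighted-++-zerosʳ : ∀ p {q} (x : Fin p → Carrierᴹ) I w →
    sumᴹ M (p + q) (weighted (x ++ replicate q 0ᴹ) I w)
      ≈ᴹ sumᴹ M p (weighted x (I ∘ (_↑ˡ q)) (w ∘ (_↑ˡ q)))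
  sumᴹ-weighted-++-zerosʳ p {q} x I w = ≈ᴹ-trans (sumᴹ-weighted-++ p x _ I w)
    (≈ᴹ-trans (+ᴹ-cong ≈ᴹ-refl (sumᴹ-zero (weighted-zeros {q} _ _))) (+ᴹ-identityʳ _))

  sumᴹ-weighted-zeros-++ : ∀ p {q} (y : Fin q → Carrierᴹ) I w →
    sumᴹ M (p + q) (weighted (replicate p 0ᴹ ++ y) I w)
      ≈ᴹ sumᴹ M q (weighted y (I ∘ (p ↑ʳ_)) (w ∘ (p ↑ʳ_)))
  sumᴹ-weighted-zeros-++ p y I w = ≈ᴹ-trans (sumᴹ-weighted-++ p _ y I w)
    (≈ᴹ-trans (+ᴹ-cong (sumᴹ-zero (weighted-zeros {p} _ _)) ≈ᴹ-refl) (+ᴹ-identityˡ _))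

  module _ {a} {A : Pred Carrier a} where

    WeightedZeroSum-resp : ∀ {k} {x x′ : Fin k → Carrierᴹ} → (∀ i → x i ≈ᴹ x′ i) →
      WeightedZeroSum A k x → WeightedZeroSum A k x′
    WeightedZeroSum-resp x≈x′ = ZeroSumOf-cong {A = A} (weighted-cong x≈x′)

    WeightedZeroSum-tail⁻ : ∀ {k} {x : Fin (suc k) → Carrierᴹ} →
      WeightedZeroSum A k (tail x) → WeightedZeroSum A (suc k) x
    WeightedZeroSum-tail⁻ (I , w , (i , I[i]) , A[w] , Σ≈0) =
      false ∷ I , 0# ∷ w , (suc i , I[i]) , (λ { zero () ; (suc j) → A[w] j }) ,
      ≈ᴹ-trans (+ᴹ-identityˡ _) Σ≈0

    AllHaveWZS-suc : ∀ {k} → AllHaveWZS M A k → AllHaveWZS M A (suc k)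
    AllHaveWZS-suc all x = WeightedZeroSum⇒HasWeightedZeroSumSubseq {A = A} {x = x}
      (WeightedZeroSum-tail⁻ {x = x} (HasWeightedZeroSumSubseq⇒WeightedZeroSum {A = A} (all (tail x))))

    AllHaveWZS-mono′ : ∀ {k k′} → k ≤′ k′ → AllHaveWZS M A k → AllHaveWZS M A k′
    AllHaveWZS-mono′ ≤′-refl        = id
    AllHaveWZS-mono′ (≤′-step k≤′k′) = AllHaveWZS-suc ∘ AllHaveWZS-mono′ k≤′k′

    AllHaveWZS-mono : ∀ {k k′} → k ≤ k′ → AllHaveWZS M A k → AllHaveWZS M A k′
    AllHaveWZS-mono = AllHaveWZS-mono′ ∘ ≤⇒≤′

    ¬AllHaveWZS-zero : ¬ AllHaveWZS M A 0
    ¬AllHaveWZS-zero all with all (λ ())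
    ... | _ , _ , (() , _) , _

    IsDavenport-suc⇒¬AllHaveWZS : ∀ {p} → IsDavenport M A (suc p) → ¬ AllHaveWZS M A p
    IsDavenport-suc⇒¬AllHaveWZS {zero}  _                = ¬AllHaveWZS-zero
    IsDavenport-suc⇒¬AllHaveWZS {suc p} (_ , _ , minimal) = minimal (suc p) (s≤s z≤n) (n<1+n (suc p))

open WeightedSums

module _ {r ℓr r′ ℓr′ m ℓm m′ ℓm′} {R : Ring r ℓr} {R′ : Ring r′ ℓr′}
         (M : LeftModule R m ℓm) (N : LeftModule R′ m′ ℓm′) where
  private
    module M = LeftModule M
    module N = LeftModule N

  sumᴹ-weighted-proj₁ : ∀ k (z : Fin k → M.Carrierᴹ × N.Carrierᴹ) I w →
    proj₁ (sumᴹ (M ⊠ N) k (weighted (M ⊠ N) z I w)) ≡ sumᴹ M k (weighted M (proj₁ ∘ z) I (proj₁ ∘ w))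
  sumᴹ-weighted-proj₁ zero    z I w = refl
  sumᴹ-weighted-proj₁ (suc k) z I w =
    cong₂ M._+ᴹ_ (if-float proj₁ (I zero)) (sumᴹ-weighted-proj₁ k (z ∘ suc) (I ∘ suc) (w ∘ suc))

  sumᴹ-weighted-proj₂ : ∀ k (z : Fin k → M.Carrierᴹ × N.Carrierᴹ) I w →
    proj₂ (sumᴹ (M ⊠ N) k (weighted (M ⊠ N) z I w)) ≡ sumᴹ N k (weighted N (proj₂ ∘ z) I (proj₂ ∘ w))
  sumᴹ-weighted-proj₂ zero    z I w = refl
  sumᴹ-weighted-proj₂ (suc k) z I w =
    cong₂ N._+ᴹ_ (if-float proj₂ (I zero)) (sumᴹ-weighted-proj₂ k (z ∘ suc) (I ∘ suc) (w ∘ suc))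

  _⊕_ : ∀ {p q} → (Fin p → M.Carrierᴹ) → (Fin q → N.Carrierᴹ) → Fin (p + q) → M.Carrierᴹ × N.Carrierᴹ
  _⊕_ {p} {q} x y = zipWith _,_ (x ++ replicate q M.0ᴹ) (replicate p N.0ᴹ ++ y)

  module _ {a b} {A : Pred (Ring.Carrier R) a} {B : Pred (Ring.Carrier R′) b} where

    WeightedZeroSum-⊕ : ∀ {p q} (x : Fin p → M.Carrierᴹ) (y : Fin q → N.Carrierᴹ) →
      WeightedZeroSum (M ⊠ N) (A ×ˢ B) (p + q) (x ⊕ y) →
      WeightedZeroSum M A p x ⊎ WeightedZeroSum N B q y
    WeightedZeroSum-⊕ {p} {q} x y (I , w , I≢∅ , A×B[w] , Σ₁≈0 , Σ₂≈0) with ∃-↑ˡ⊎↑ʳ p I≢∅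
    ... | inj₁ I∘↑ˡ≢∅ =
      inj₁ (I ∘ (_↑ˡ q) , proj₁ ∘ w ∘ (_↑ˡ q) , I∘↑ˡ≢∅ , (λ i → proj₁ ∘ A×B[w] (i ↑ˡ q)) ,
      M.≈ᴹ-trans (M.≈ᴹ-sym (sumᴹ-weighted-++-zerosʳ M p x I (proj₁ ∘ w)))
        (M.≈ᴹ-trans (M.≈ᴹ-reflexive (sym (sumᴹ-weighted-proj₁ (p + q) (x ⊕ y) I w))) Σ₁≈0))
    ... | inj₂ I∘↑ʳ≢∅ =
      inj₂ (I ∘ (p ↑ʳ_) , proj₂ ∘ w ∘ (p ↑ʳ_) , I∘↑ʳ≢∅ , (λ j → proj₂ ∘ A×B[w] (p ↑ʳ j)) ,
      N.≈ᴹ-trans (N.≈ᴹ-sym (sumᴹ-weighted-zeros-++ N p y I (proj₂ ∘ w)))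
        (N.≈ᴹ-trans (N.≈ᴹ-reflexive (sym (sumᴹ-weighted-proj₂ (p + q) (x ⊕ y) I w))) Σ₂≈0))

    AllHaveWZS-⊠ : ∀ {p q} → IsFinite M → IsFinite N →
      AllHaveWZS (M ⊠ N) (A ×ˢ B) (p + q) → AllHaveWZS M A p ⊎ AllHaveWZS N B q
    AllHaveWZS-⊠ {p} {q} (_ , enumᴹ , enumᴹ-surjective) (_ , enumᴺ , enumᴺ-surjective) all =
      Sum.map (WeightedZeroSum⇒HasWeightedZeroSumSubseq M {A = A} ∘_)
              (WeightedZeroSum⇒HasWeightedZeroSumSubseq N {A = B} ∘_)
        (swap every-y-or-every-x)
      where
      x-or-y : ∀ x y → WeightedZeroSum M A p x ⊎ WeightedZeroSum N B q y
      x-or-y x y =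
        WeightedZeroSum-⊕ x y (HasWeightedZeroSumSubseq⇒WeightedZeroSum (M ⊠ N) {A = A ×ˢ B} (all (x ⊕ y)))
      x-or-every-y : ∀ x → WeightedZeroSum M A p x ⊎ (∀ y → WeightedZeroSum N B q y)
      x-or-every-y x =
        ⊎-∀-sequences N.≈ᴹ-setoid enumᴺ enumᴺ-surjective q (WeightedZeroSum-resp N {A = B}) (x-or-y x)
      every-y-or-every-x : (∀ y → WeightedZeroSum N B q y) ⊎ (∀ x → WeightedZeroSum M A p x)
      every-y-or-every-x =
        ⊎-∀-sequences M.≈ᴹ-setoid enumᴹ enumᴹ-surjective p (WeightedZeroSum-resp M {A = A}) (swap ∘ x-or-every-y)

mainTheorem11 : {r ℓr r′ ℓr′ m ℓm m′ ℓm′ a b : Level}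
    (R : Ring r ℓr) (R′ : Ring r′ ℓr′)
    (M : LeftModule R m ℓm) (N : LeftModule R′ m′ ℓm′) →
    IsFinite M → IsFinite N →
    (A : Pred (Ring.Carrier R) a) (B : Pred (Ring.Carrier R′) b) →
    (d e f : ℕ) →
    IsDavenport M A d → IsDavenport N B e →
    IsDavenport (M ⊠ N) (A ×ˢ B) f →
    d + e ∸ 1 ≤ f
mainTheorem11 R R′ M N finM finN A B zero    e       f (() , _) _ _
mainTheorem11 R R′ M N finM finN A B (suc p) zero    f _ (() , _) _
mainTheorem11 R R′ M N finM finN A B (suc p) (suc q) f Dᴹ Dᴺ (_ , allᶠ , _) =
  subst (_≤ f) (sym (+-suc p q)) (≰⇒> f≰p+q)
  where
  f≰p+q : ¬ f ≤ p + q
  f≰p+q f≤p+q = [ IsDavenport-suc⇒¬AllHaveWZS M {A = A} Dᴹ , IsDavenport-suc⇒¬AllHaveWZS N {A = B} Dᴺ ]′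
    (AllHaveWZS-⊠ M N {A = A} {B = B} finM finN (AllHaveWZS-mono (M ⊠ N) {A = A ×ˢ B} f≤p+q allᶠ))
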